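{- Let $S=S[1..n]$ be a string and $0\le k\le n-1$. Let $A[1..n]$ and $B[1..n]$ be integer arrays such that, for every $i$: (1) $A[i]=j$ where $\mathrm{LSUS}_j^k$ is the rightmost $\mathrm{SLS}_i^k$, if $\mathrm{SLS}_i^k$ exists, and $A[i]=\mathtt{NIL}$ otherwise; (2) $B[i]=i+|\mathrm{LSUS}_i^k|-1$ (the ending position of $\mathrm{LSUS}_i^k$) if $\mathrm{LSUS}_i^k$ exists, and $B[i]=\mathtt{NIL}$ otherwise. There is an algorithm that works in place in $A$ and $B$ (using no working memory beyond these arrays except a constant number of additional machine words) and runs in $O(n)$ time. At the end of the computation, for every $i=1,\dots,n$, the pair $(A[i],B[i])$ gives the start and ending positions of a $k$-mismatch SUS covering position $i$, i.e. $S[A[i]..B[i]]$ is a $k$-mismatch SUS covering $i$.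
   Context: For $1\le i\le j\le n$, $S[i..j]=S[i]\cdots S[j]$ is a substring of length $j-i+1$, and it covers position $q$ if $i\le q\le j$. $H$ denotes the Hamming distance between equal-length strings. A substring $S[i..j]$ is $k$-mismatch unique if there is no substring $S[i'..j']$ with $i'\ne i$, $j'-i'=j-i$ and $H(S[i..j],S[i'..j'])\le k$. A $k$-mismatch SUS covering $p$ is a $k$-mismatch unique substring covering $p$ of minimum length among all such substrings. $\mathrm{LSUS}_i^k$ is the shortest $k$-mismatch unique substring starting at position $i$, if one exists. An $\mathrm{SLS}_i^k$ is an existing $\mathrm{LSUS}_j^k$ covering $i$ of minimum length among all existing $\mathrm{LSUS}_{j'}^k$ covering $i$. The rightmost $\mathrm{SLS}_i^k$ is the one with the largest start position. $\mathtt{NIL}$ is a special marker value. -}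

module Defs where

open import Data.Nat using (ℕ; zero; suc; _+_; _*_; _∸_; _^_; _≤_; _<_; _≟_; _<ᵇ_; _≤ᵇ_; _≡ᵇ_)
open import Data.Bool using (Bool; true; false; if_then_else_; _∧_)
open import Data.Fin using (Fin)
open import Data.Fin.Properties using () renaming (_≟_ to _≟F_)
open import Data.List using (List; []; _∷_; length)
open import Data.Maybe using (Maybe; just; nothing)
open import Data.Product using (Σ; ∃; _×_; _,_)
open import Data.Sum using (_⊎_)
open import Relation.Nullary using (¬_; yes; no)
open import Relation.Binary.PropositionalEquality using (_≡_; _≢_)

-- Strings.  A string of length n over an integer alphabet is a function
-- S : ℕ → ℕ of which only the positions 1..n are meaningful.
-- Positions are 1-based, as in the paper.

ham : (S : ℕ → ℕ) → ℕ → ℕ → ℕ → ℕ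
ham S i i' zero = 0
ham S i i' (suc ℓ) with S (i + ℓ) ≟ S (i' + ℓ)
... | yes _ = ham S i i' ℓ
... | no  _ = suc (ham S i i' ℓ)

KUnique : (S : ℕ → ℕ) (n k : ℕ) → ℕ → ℕ → Set
KUnique S n k i j =
  1 ≤ i × i ≤ j × j ≤ n ×
  (∀ i' → 1 ≤ i' → i' + (j ∸ i) ≤ n → i' ≢ i →
     k < ham S i i' (suc (j ∸ i)))

Covers : ℕ → ℕ → ℕ → Set
Covers i j q = i ≤ q × q ≤ j

IsSUS : (S : ℕ → ℕ) (n k : ℕ) → ℕ → ℕ → ℕ → Set
IsSUS S n k i j q =
  KUnique S n k i j × Covers i j q ×
  (∀ i' j' → KUnique S n k i' j' → Covers i' j' q → j ∸ i ≤ j' ∸ i')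

IsLSUS : (S : ℕ → ℕ) (n k : ℕ) → ℕ → ℕ → Set
IsLSUS S n k i j =
  KUnique S n k i j × (∀ j' → KUnique S n k i j' → j ≤ j')

IsSLS : (S : ℕ → ℕ) (n k : ℕ) → ℕ → ℕ → ℕ → Set
IsSLS S n k i j e =
  IsLSUS S n k j e × Covers j e i ×
  (∀ j' e' → IsLSUS S n k j' e' → Covers j' e' i → e ∸ j ≤ e' ∸ j')

IsRightmostSLS : (S : ℕ → ℕ) (n k : ℕ) → ℕ → ℕ → Set
IsRightmostSLS S n k i j =
  Σ ℕ (λ e → IsSLS S n k i j e) ×
  (∀ j' e' → IsSLS S n k i j' e' → j' ≤ j)

-- NIL is encoded as 0 (valid positions are 1..n).
NIL : ℕ
NIL = 0

SpecA : (S : ℕ → ℕ) (n k : ℕ) → (ℕ → ℕ) → Set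
SpecA S n k A = ∀ i → 1 ≤ i → i ≤ n →
  IsRightmostSLS S n k i (A i) ⊎
  (A i ≡ NIL × ¬ (Σ ℕ λ j → Σ ℕ λ e → IsSLS S n k i j e))

SpecB : (S : ℕ → ℕ) (n k : ℕ) → (ℕ → ℕ) → Set
SpecB S n k B = ∀ i → 1 ≤ i → i ≤ n →
  IsLSUS S n k i (B i) ⊎
  (B i ≡ NIL × ¬ (Σ ℕ λ e → IsLSUS S n k i e))

-- Machine model: a word-RAM whose only memory is the two arrays A[1..n],
-- B[1..n] plus a constant number R of registers (machine words).
-- Every stored value must be < W (the word bound, W = (n+2)^d).
-- The string S can be accessed read-only by character comparison.

data Instr (R : ℕ) : Set where
  set   : Fin R → ℕ → Instr R
  getN  : Fin R → Instr R
  getK  : Fin R → Instr R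
  add   : Fin R → Fin R → Fin R → Instr R
  sub   : Fin R → Fin R → Fin R → Instr R
  ldA   : Fin R → Fin R → Instr R
  ldB   : Fin R → Fin R → Instr R
  stA   : Fin R → Fin R → Instr R
  stB   : Fin R → Fin R → Instr R
  jlt   : Fin R → Fin R → ℕ → Instr R
  jeq   : Fin R → Fin R → ℕ → Instr R
  jchr  : Fin R → Fin R → ℕ → Instr R

record Config (R : ℕ) : Set where
  constructor cfg
  field
    pc   : ℕ
    regs : Fin R → ℕ
    arrA : ℕ → ℕ
    arrB : ℕ → ℕ
open Config public

nth : {X : Set} → List X → ℕ → Maybe X
nth [] _ = nothing
nth (x ∷ xs) zero = just x
nth (x ∷ xs) (suc m) = nth xs m

upd : {R : ℕ} → (Fin R → ℕ) → Fin R → ℕ → Fin R → ℕ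
upd f r v r' with r ≟F r'
... | yes _ = v
... | no  _ = f r'

updN : (ℕ → ℕ) → ℕ → ℕ → ℕ → ℕ
updN f i v i' = if i ≡ᵇ i' then v else f i'

module Machine (W n k : ℕ) (S : ℕ → ℕ) {R : ℕ} (P : List (Instr R)) where

  inRange : ℕ → Bool
  inRange i = (1 ≤ᵇ i) ∧ (i ≤ᵇ n)

  wr : Config R → Fin R → ℕ → Maybe (Config R)
  wr (cfg p g a b) r v =
    if v <ᵇ W then just (cfg (suc p) (upd g r v) a b) else nothing

  jmp : Config R → Bool → ℕ → Maybe (Config R)
  jmp (cfg p g a b) c t = just (cfg (if c then t else suc p) g a b)

  exec : Instr R → Config R → Maybe (Config R)
  exec (set r v) c = wr c r v
  exec (getN r) c = wr c r n
  exec (getK r) c = wr c r k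
  exec (add d x y) c = wr c d (regs c x + regs c y)
  exec (sub d x y) c = wr c d (regs c x ∸ regs c y)
  exec (ldA d r) c =
    if inRange (regs c r) then wr c d (arrA c (regs c r)) else nothing
  exec (ldB d r) c =
    if inRange (regs c r) then wr c d (arrB c (regs c r)) else nothing
  exec (stA r v) (cfg p g a b) =
    if inRange (g r) then just (cfg (suc p) g (updN a (g r) (g v)) b) else nothing
  exec (stB r v) (cfg p g a b) =
    if inRange (g r) then just (cfg (suc p) g a (updN b (g r) (g v))) else nothing
  exec (jlt x y t) c = jmp c (regs c x <ᵇ regs c y) t
  exec (jeq x y t) c = jmp c (regs c x ≡ᵇ regs c y) t
  exec (jchr x y t) c =
    if inRange (regs c x) ∧ inRange (regs c y)
    then jmp c (S (regs c x) ≡ᵇ S (regs c y)) t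
    else nothing

  -- one step; a halted machine (pc outside the program) stays put;
  -- nothing = run-time error
  step : Config R → Maybe (Config R)
  step c with nth P (pc c)
  ... | nothing = just c
  ... | just ins = exec ins c

  run : ℕ → Config R → Maybe (Config R)
  run zero c = just c
  run (suc t) c with step c
  ... | nothing = nothing
  ... | just c' = run t c'

  Halted : Config R → Set
  Halted c = length P ≤ pc c

initConfig : {R : ℕ} → (ℕ → ℕ) → (ℕ → ℕ) → Config R
initConfig A B = cfg 0 (λ _ → 0) A B

module Submission where

-- A k-mismatch unique S[s..t] covering i either has LSUS_s covering i, and is then no shorter than
-- the rightmost SLS_i recorded in A[i], or LSUS_s ends before i. In the second case s ≤ p for the
-- largest p ≤ i whose LSUS_p ends by i, and S[p..i] is unique since uniqueness survives extension to
-- the right. As i runs from n down to 1 this p only decreases, so one leftward sweep of a pointer finds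
-- all of them in O(n) steps, and the shorter of (A[i], B[A[i]]) and (p, i) is a SUS covering i.
-- Overwriting position i is harmless: all later reads of A and B are at positions below i.

open import Defs
open import Data.Nat using (ℕ; zero; suc; _+_; _*_; _^_; _∸_; _≤_; _<_; z≤n; s≤s; _≟_; _≤?_; _<?_; _<ᵇ_; _≡ᵇ_)
open import Data.Nat.Properties
open import Data.Nat.Induction using (<-rec)
open import Data.Nat.Tactic.RingSolver using (solve-∀)
open import Data.Bool using (true; false; T)
open import Data.Bool.Properties using (T-≡; ¬-not)
open import Data.Fin using (Fin; #_)
open import Data.List using (List; []; _∷_; length)
open import Data.Maybe using (just; nothing)
open import Data.Product using (Σ; _×_; _,_; proj₁)
open import Data.Sum using (_⊎_; inj₁; inj₂)
open import Data.Empty using (⊥-elim)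
open import Function.Bundles using (Equivalence)
open import Relation.Nullary using (¬_; Dec; yes; no)
open import Relation.Nullary.Decidable using (_×-dec_; _→-dec_; ¬?; map′)
open import Relation.Unary using (Decidable)
open import Relation.Binary.PropositionalEquality using (_≡_; _≢_; refl; sym; trans; cong; cong₂; subst; subst₂)

module _ {P : ℕ → Set} (P? : Decidable P) where

  Least : Set
  Least = Σ ℕ λ e → P e × (∀ {e'} → P e' → e ≤ e')

  minimal : ∀ {m} → P m → Least
  minimal {m} = <-rec (λ m → P m → Least) search m
    where
    search : ∀ m → (∀ {m'} → m' < m → P m' → Least) → P m → Least
    search m smaller Pm with anyUpTo? P? m
    ... | yes (m' , m'<m , Pm') = smaller m'<m Pm'
    ... | no none = m , Pm , λ {e'} Pe' → ≮⇒≥ λ e'<m → none (e' , e'<m , Pe')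

module Uniqueness (S : ℕ → ℕ) (n k : ℕ) where

  ham≤ham-suc : ∀ i i' ℓ → ham S i i' ℓ ≤ ham S i i' (suc ℓ)
  ham≤ham-suc i i' ℓ with S (i + ℓ) ≟ S (i' + ℓ)
  ... | yes _ = ≤-refl
  ... | no _ = n≤1+n _

  ham-mono : ∀ i i' {ℓ ℓ'} → ℓ ≤ ℓ' → ham S i i' ℓ ≤ ham S i i' ℓ'
  ham-mono i i' {ℓ' = zero} z≤n = ≤-refl
  ham-mono i i' {ℓ' = suc ℓ'} ℓ≤1+ℓ' with m≤n⇒m<n∨m≡n ℓ≤1+ℓ'
  ... | inj₁ (s≤s ℓ≤ℓ') = ≤-trans (ham-mono i i' ℓ≤ℓ') (ham≤ham-suc i i' ℓ')
  ... | inj₂ refl = ≤-refl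

  kUnique-extendʳ : ∀ {i j j'} → KUnique S n k i j → j ≤ j' → j' ≤ n → KUnique S n k i j'
  kUnique-extendʳ {i} {j} {j'} (1≤i , i≤j , _ , far) j≤j' j'≤n =
    1≤i , ≤-trans i≤j j≤j' , j'≤n ,
    λ i' 1≤i' fits i'≢i →
      <-≤-trans (far i' 1≤i' (≤-trans (+-monoʳ-≤ i' ℓ≤ℓ') fits) i'≢i) (ham-mono i i' (s≤s ℓ≤ℓ'))
    where
    ℓ≤ℓ' : j ∸ i ≤ j' ∸ i
    ℓ≤ℓ' = ∸-monoˡ-≤ i j≤j'

  kUnique? : ∀ i j → Dec (KUnique S n k i j)
  kUnique? i j = 1 ≤? i ×-dec i ≤? j ×-dec j ≤? n ×-dec far?
    where
    Far : ℕ → Set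
    Far i' = 1 ≤ i' → i' + (j ∸ i) ≤ n → i' ≢ i → k < ham S i i' (suc (j ∸ i))

    far? : Dec (∀ i' → Far i')
    far? = map′ (λ far i' 1≤i' fits → far (s≤s (≤-trans (m≤m+n i' (j ∸ i)) fits)) 1≤i' fits)
                (λ far {i'} _ → far i')
                (allUpTo? (λ i' → 1 ≤? i' →-dec i' + (j ∸ i) ≤? n →-dec ¬? (i' ≟ i) →-dec
                                   k <? ham S i i' (suc (j ∸ i)))
                          (suc n))

  kUnique-whole : 1 ≤ n → KUnique S n k 1 n
  kUnique-whole (s≤s {n = m} _) = ≤-refl , s≤s z≤n , ≤-refl , only-start
    where
    only-start : ∀ i' → 1 ≤ i' → i' + m ≤ suc m → i' ≢ 1 → k < ham S 1 i' (suc m)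
    only-start i' 1≤i' fits i'≢1 = ⊥-elim (i'≢1 (≤-antisym (+-cancelʳ-≤ m i' 1 fits) 1≤i'))

  lsus-unique : ∀ {i e e'} → IsLSUS S n k i e → IsLSUS S n k i e' → e ≡ e'
  lsus-unique (u , least) (u' , least') = ≤-antisym (least _ u') (least' _ u)

  lsus-within : ∀ {i j} → KUnique S n k i j → Σ ℕ λ e → IsLSUS S n k i e × e ≤ j
  lsus-within {i} u with minimal (kUnique? i) u
  ... | e , uₑ , least = e , (uₑ , λ _ → least) , least u

  lsus-end≥1 : ∀ {i e} → IsLSUS S n k i e → 1 ≤ e
  lsus-end≥1 ((1≤i , i≤e , _) , _) = ≤-trans 1≤i i≤e

  nil-not-sls : ∀ {i e} → ¬ IsSLS S n k i NIL e
  nil-not-sls (((() , _) , _) , _)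

module Arrays (S : ℕ → ℕ) (n k : ℕ) (A B : ℕ → ℕ)
              (specA : SpecA S n k A) (specB : SpecB S n k B) where
  open Uniqueness S n k

  B-lsus : ∀ {i e} → IsLSUS S n k i e → B i ≡ e
  B-lsus {i} l@((1≤i , i≤e , e≤n , _) , _) with specB i 1≤i (≤-trans i≤e e≤n)
  ... | inj₁ l' = lsus-unique l' l
  ... | inj₂ (_ , none) = ⊥-elim (none (_ , l))

  lsus-B : ∀ {i} → 1 ≤ i → i ≤ n → B i ≢ NIL → IsLSUS S n k i (B i)
  lsus-B {i} 1≤i i≤n Bi≢NIL with specB i 1≤i i≤n
  ... | inj₁ l = l
  ... | inj₂ (Bi≡NIL , _) = ⊥-elim (Bi≢NIL Bi≡NIL)

  B≤n : ∀ {i} → 1 ≤ i → i ≤ n → B i ≤ n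
  B≤n {i} 1≤i i≤n with specB i 1≤i i≤n
  ... | inj₁ ((_ , _ , Bi≤n , _) , _) = Bi≤n
  ... | inj₂ (Bi≡NIL , _) = subst (_≤ n) (sym Bi≡NIL) z≤n

  A≤ : ∀ {i} → 1 ≤ i → i ≤ n → A i ≤ i
  A≤ {i} 1≤i i≤n with specA i 1≤i i≤n
  ... | inj₁ ((_ , _ , (Ai≤i , _) , _) , _) = Ai≤i
  ... | inj₂ (Ai≡NIL , _) = subst (_≤ i) (sym Ai≡NIL) z≤n

  B≢NIL : ∀ {i e} → IsLSUS S n k i e → B i ≢ NIL
  B≢NIL l Bi≡NIL with subst (1 ≤_) (trans (sym (B-lsus l)) Bi≡NIL) (lsus-end≥1 l)
  ... | ()

  ShortCover : ℕ → ℕ → ℕ → Set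
  ShortCover i L j = 1 ≤ j × j ≤ i × B j ≢ NIL × i ≤ B j × B j ∸ j ≤ L

  shortCover? : ∀ i L j → Dec (ShortCover i L j)
  shortCover? i L j = 1 ≤? j ×-dec j ≤? i ×-dec ¬? (B j ≟ NIL) ×-dec i ≤? B j ×-dec B j ∸ j ≤? L

  shortCover : ∀ {i j e} → IsLSUS S n k j e → Covers j e i → ShortCover i (e ∸ j) j
  shortCover l@((1≤j , _) , _) (j≤i , i≤e) rewrite sym (B-lsus l) = 1≤j , j≤i , B≢NIL l , i≤e , ≤-refl

  sls-exists : ∀ {i j e} → i ≤ n → IsLSUS S n k j e → Covers j e i →
               Σ ℕ λ j₀ → Σ ℕ λ e₀ → IsSLS S n k i j₀ e₀
  sls-exists {i} i≤n l cov@(j≤i , _)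
    with minimal (λ L → anyUpTo? (shortCover? i L) (suc i)) (_ , s≤s j≤i , shortCover l cov)
  ... | L , (j₀ , _ , 1≤j₀ , j₀≤i , Bj₀≢NIL , i≤Bj₀ , short) , least =
    j₀ , B j₀ , lsus-B 1≤j₀ (≤-trans j₀≤i i≤n) Bj₀≢NIL , (j₀≤i , i≤Bj₀) ,
    λ j' e' l' cov'@(j'≤i , _) → ≤-trans short (least (j' , s≤s j'≤i , shortCover l' cov'))

  rightmost-sls-shortest : ∀ {i j e} → 1 ≤ i → i ≤ n → IsLSUS S n k j e → Covers j e i →
                           Σ ℕ λ e₀ → IsSLS S n k i (A i) e₀ × e₀ ∸ A i ≤ e ∸ j
  rightmost-sls-shortest {i} 1≤i i≤n l cov with specA i 1≤i i≤n
  ... | inj₁ ((e₀ , sls@(_ , _ , shortest)) , _) = e₀ , sls , shortest _ _ l cov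
  ... | inj₂ (_ , none) = ⊥-elim (none (sls-exists i≤n l cov))

  NoLSUSWithin : ℕ → ℕ → Set
  NoLSUSWithin p i = ∀ j → p < j → j ≤ i → B j ≡ NIL ⊎ i < B j

  Skippable : ℕ → ℕ → Set
  Skippable i q = i < q ⊎ B q ≡ NIL ⊎ i < B q

  NoLSUSWithin-extendˡ : ∀ {p i} → Skippable i (suc p) → NoLSUSWithin (suc p) i → NoLSUSWithin p i
  NoLSUSWithin-extendˡ {p} passed none j p<j j≤i with j ≟ suc p
  ... | no j≢1+p = none j (≤∧≢⇒< p<j (λ 1+p≡j → j≢1+p (sym 1+p≡j))) j≤i
  ... | yes refl with passed
  ...   | inj₁ i<j = ⊥-elim (<⇒≱ i<j j≤i)
  ...   | inj₂ ends-late = ends-late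

  NoLSUSWithin-shrinkʳ : ∀ {p i} → NoLSUSWithin p (suc i) → NoLSUSWithin p i
  NoLSUSWithin-shrinkʳ none j p<j j≤i with none j p<j (m≤n⇒m≤1+n j≤i)
  ... | inj₁ Bj≡NIL = inj₁ Bj≡NIL
  ... | inj₂ 1+i<Bj = inj₂ (<-trans (n<1+n _) 1+i<Bj)

  lsus-start≤p : ∀ {p i j e} → NoLSUSWithin p i → IsLSUS S n k j e → j ≤ i → e < i → j ≤ p
  lsus-start≤p {p} {i} {j} none l j≤i e<i with p <? j
  ... | no p≮j = ≮⇒≥ p≮j
  ... | yes p<j with none j p<j j≤i
  ...   | inj₁ Bj≡NIL = ⊥-elim (B≢NIL l Bj≡NIL)
  ...   | inj₂ i<Bj = ⊥-elim (<-asym e<i (subst (i <_) (B-lsus l) i<Bj))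

  some-candidate-no-longer : ∀ {p i s t} → i ≤ n → NoLSUSWithin p i → KUnique S n k s t → Covers s t i →
                         (Σ ℕ λ e → IsSLS S n k i (A i) e × e ∸ A i ≤ t ∸ s) ⊎ (1 ≤ p × i ∸ p ≤ t ∸ s)
  some-candidate-no-longer {i = i} {s} i≤n none u@(1≤s , _) (s≤i , i≤t) with lsus-within u
  ... | e , l , e≤t with i ≤? e
  ...   | yes i≤e =
    let e₀ , sls , short = rightmost-sls-shortest (≤-trans 1≤s s≤i) i≤n l (s≤i , i≤e)
    in inj₁ (e₀ , sls , ≤-trans short (∸-monoˡ-≤ s e≤t))
  ...   | no i≰e =
    let s≤p = lsus-start≤p none l s≤i (≰⇒> i≰e)
    in inj₂ (≤-trans 1≤s s≤p , ≤-trans (∸-monoʳ-≤ i s≤p) (∸-monoˡ-≤ s i≤t))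

  shortest-isSUS : ∀ {p i s t} → i ≤ n → NoLSUSWithin p i → KUnique S n k s t → Covers s t i →
                   (∀ e → IsSLS S n k i (A i) e → t ∸ s ≤ e ∸ A i) → (1 ≤ p → t ∸ s ≤ i ∸ p) →
                   IsSUS S n k s t i
  shortest-isSUS {p} {i} {s} {t} i≤n none u cov ≤sls ≤prefix = u , cov , shortest
    where
    shortest : ∀ s' t' → KUnique S n k s' t' → Covers s' t' i → t ∸ s ≤ t' ∸ s'
    shortest s' t' u' cov' with some-candidate-no-longer i≤n none u' cov'
    ... | inj₁ (e , sls , le) = ≤-trans (≤sls e sls) le
    ... | inj₂ (1≤p , le) = ≤-trans (≤prefix 1≤p) le

  sls-isSUS : ∀ {p i} → 1 ≤ i → i ≤ n → NoLSUSWithin p i → A i ≢ NIL →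
              (1 ≤ p → B (A i) ∸ A i ≤ i ∸ p) → IsSUS S n k (A i) (B (A i)) i
  sls-isSUS {i = i} 1≤i i≤n none Ai≢NIL ≤prefix with specA i 1≤i i≤n
  ... | inj₂ (Ai≡NIL , _) = ⊥-elim (Ai≢NIL Ai≡NIL)
  ... | inj₁ ((e , (l , cov , _)) , _) rewrite B-lsus l =
    shortest-isSUS i≤n none (proj₁ l) cov
      (λ e' (l' , _) → ≤-reflexive (cong (_∸ A i) (lsus-unique l l'))) ≤prefix

  ScanStopped : ℕ → ℕ → Set
  ScanStopped p i = p ≡ 0 ⊎ (p ≤ i × B p ≢ NIL × B p ≤ i)

  ScanStopped⇒p≤i : ∀ {p i} → ScanStopped p i → p ≤ i
  ScanStopped⇒p≤i (inj₁ refl) = z≤n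
  ScanStopped⇒p≤i (inj₂ (p≤i , _)) = p≤i

  prefix-isSUS : ∀ {p i} → i ≤ n → NoLSUSWithin p i → 1 ≤ p → p ≤ i → B p ≢ NIL → B p ≤ i →
                 (∀ e → IsSLS S n k i (A i) e → i ∸ p ≤ e ∸ A i) → IsSUS S n k p i i
  prefix-isSUS {p} {i} i≤n none 1≤p p≤i Bp≢NIL Bp≤i ≤sls =
    shortest-isSUS i≤n none u (p≤i , ≤-refl) ≤sls (λ _ → ≤-refl)
    where
    u : KUnique S n k p i
    u = kUnique-extendʳ (proj₁ (lsus-B 1≤p (≤-trans p≤i i≤n) Bp≢NIL)) Bp≤i i≤n

  prefix-isSUS-shorter : ∀ {p i} → i ≤ n → NoLSUSWithin p i → 1 ≤ p → p ≤ i → B p ≢ NIL → B p ≤ i →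
                         i ∸ p < B (A i) ∸ A i → IsSUS S n k p i i
  prefix-isSUS-shorter {p} {i} i≤n none 1≤p p≤i Bp≢NIL Bp≤i shorter =
    prefix-isSUS i≤n none 1≤p p≤i Bp≢NIL Bp≤i
      (λ e (l , _) → <⇒≤ (subst (λ e → i ∸ p < e ∸ A i) (B-lsus l) shorter))

  -- Without an SLS, the whole string S[1..n] shows that the scan stopped at some p ≥ 1.
  prefix-isSUS-nil : ∀ {p i} → 1 ≤ n → 1 ≤ i → i ≤ n → NoLSUSWithin p i → ScanStopped p i →
                     A i ≡ NIL → IsSUS S n k p i i
  prefix-isSUS-nil {i = i} 1≤n 1≤i i≤n none stopped Ai≡NIL
    with some-candidate-no-longer i≤n none (kUnique-whole 1≤n) (1≤i , i≤n)
  ... | inj₁ (_ , sls , _) = ⊥-elim (nil-not-sls (subst (λ j → IsSLS S n k i j _) Ai≡NIL sls))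
  ... | inj₂ (1≤p , _) with stopped
  ...   | inj₁ refl = ⊥-elim (≤⇒≯ 1≤p (s≤s z≤n))
  ...   | inj₂ (p≤i , Bp≢NIL , Bp≤i) =
    prefix-isSUS i≤n none 1≤p p≤i Bp≢NIL Bp≤i
      (λ e sls → ⊥-elim (nil-not-sls (subst (λ j → IsSLS S n k i j e) Ai≡NIL sls)))

true-if-T : ∀ {b} → T b → b ≡ true
true-if-T = Equivalence.to T-≡

false-if-¬T : ∀ {b} → ¬ T b → b ≡ false
false-if-¬T ¬Tb = ¬-not (λ b≡true → ¬Tb (Equivalence.from T-≡ b≡true))

nth-beyond : ∀ {X : Set} (xs : List X) {m} → length xs ≤ m → nth xs m ≡ nothing
nth-beyond [] _ = refl
nth-beyond (x ∷ xs) (s≤s le) = nth-beyond xs le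

module Execution (W n k : ℕ) (S : ℕ → ℕ) {R : ℕ} (P : List (Instr R)) where
  open Machine W n k S P

  run-step : ∀ {c c' t} → step c ≡ just c' → run (suc t) c ≡ run t c'
  run-step {c} eq with step c
  run-step refl | just _ = refl

  run-halted : ∀ {c} → Halted c → ∀ t → run t c ≡ just c
  run-halted h zero = refl
  run-halted {c} h (suc t) = trans (run-step halted-step) (run-halted h t)
    where
    halted-step : step c ≡ just c
    halted-step with nth P (pc c) | nth-beyond P h
    ... | .nothing | refl = refl

  run-extend : ∀ {t t' c fin} → t ≤ t' → run t c ≡ just fin → Halted fin → run t' c ≡ just fin
  run-extend {zero} {t'} z≤n refl h = run-halted h t'
  run-extend {suc t} {suc t'} {c} (s≤s t≤t') r h with step c
  ... | just c' = run-extend t≤t' r h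

  HaltsWithin : (Config R → Set) → ℕ → Config R → Set
  HaltsWithin Good t c =
    Σ ℕ λ t' → t' ≤ t × Σ (Config R) λ fin → run t' c ≡ just fin × Halted fin × Good fin

  halts-run : ∀ {Good c t} → HaltsWithin Good t c →
              Σ (Config R) λ fin → run t c ≡ just fin × Halted fin × Good fin
  halts-run (t' , t'≤t , fin , ran , halted , good) = fin , run-extend t'≤t ran halted , halted , good

  infixr 4 _▸_

  _▸_ : ∀ {Good c c' t} → step c ≡ just c' → HaltsWithin Good t c' → HaltsWithin Good (suc t) c
  eq ▸ (t' , t'≤t , fin , r , h , good) = suc t' , s≤s t'≤t , fin , trans (run-step eq) r , h , good

  halts-mono : ∀ {Good c t t'} → t ≤ t' → HaltsWithin Good t c → HaltsWithin Good t' c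
  halts-mono t≤t' (t₀ , t₀≤t , rest) = t₀ , ≤-trans t₀≤t t≤t' , rest

  halts-later : ∀ {Good c t} d → HaltsWithin Good t c → HaltsWithin Good (d + t) c
  halts-later {t = t} d = halts-mono (m≤n+m t d)

  inRange-true : ∀ {x} → 1 ≤ x → x ≤ n → inRange x ≡ true
  inRange-true 1≤x x≤n rewrite true-if-T (≤⇒≤ᵇ 1≤x) | true-if-T (≤⇒≤ᵇ x≤n) = refl

  module _ {p : ℕ} {g : Fin R → ℕ} {a b : ℕ → ℕ} where

    write-ok : ∀ r {v} → v < W → wr (cfg p g a b) r v ≡ just (cfg (suc p) (upd g r v) a b)
    write-ok r v<W rewrite true-if-T (<⇒<ᵇ v<W) = refl

    ldA-ok : ∀ d r → 1 ≤ g r → g r ≤ n → a (g r) < W →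
             exec (ldA d r) (cfg p g a b) ≡ just (cfg (suc p) (upd g d (a (g r))) a b)
    ldA-ok d r 1≤x x≤n fits rewrite inRange-true 1≤x x≤n = write-ok d fits

    ldB-ok : ∀ d r → 1 ≤ g r → g r ≤ n → b (g r) < W →
             exec (ldB d r) (cfg p g a b) ≡ just (cfg (suc p) (upd g d (b (g r))) a b)
    ldB-ok d r 1≤x x≤n fits rewrite inRange-true 1≤x x≤n = write-ok d fits

    stA-ok : ∀ r v → 1 ≤ g r → g r ≤ n →
             exec (stA r v) (cfg p g a b) ≡ just (cfg (suc p) g (updN a (g r) (g v)) b)
    stA-ok r v 1≤x x≤n rewrite inRange-true 1≤x x≤n = refl

    stB-ok : ∀ r v → 1 ≤ g r → g r ≤ n →
             exec (stB r v) (cfg p g a b) ≡ just (cfg (suc p) g a (updN b (g r) (g v)))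
    stB-ok r v 1≤x x≤n rewrite inRange-true 1≤x x≤n = refl

    jeq-taken : ∀ x y {t} → g x ≡ g y → exec (jeq x y t) (cfg p g a b) ≡ just (cfg t g a b)
    jeq-taken x y eq rewrite true-if-T (≡⇒≡ᵇ (g x) (g y) eq) = refl

    jeq-skipped : ∀ x y {t} → g x ≢ g y → exec (jeq x y t) (cfg p g a b) ≡ just (cfg (suc p) g a b)
    jeq-skipped x y neq rewrite false-if-¬T {g x ≡ᵇ g y} (λ eq → neq (≡ᵇ⇒≡ _ _ eq)) = refl

    jlt-taken : ∀ x y {t} → g x < g y → exec (jlt x y t) (cfg p g a b) ≡ just (cfg t g a b)
    jlt-taken x y lt rewrite true-if-T (<⇒<ᵇ lt) = refl

    jlt-skipped : ∀ x y {t} → ¬ g x < g y → exec (jlt x y t) (cfg p g a b) ≡ just (cfg (suc p) g a b)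
    jlt-skipped x y nlt rewrite false-if-¬T {g x <ᵇ g y} (λ lt → nlt (<ᵇ⇒< _ _ lt)) = refl

-- Registers: 0 holds 0, 1 holds 1, 2 holds i, 3 holds p, 4–7 are scratch.
--   p := n; for i = n downto 1:
--     while p ≠ 0 and (i < p or B[p] = NIL or i < B[p]): p := p − 1
--     if A[i] ≠ NIL and (p = 0 or B[A[i]] − A[i] ≤ i − p)
--       then (A[i], B[i]) := (A[i], B[A[i]])  else (A[i], B[i]) := (p, i)
program : List (Instr 8)
program =
  getN (# 2) ∷                 -- 0
  getN (# 3) ∷                 -- 1
  set (# 1) 1 ∷                -- 2
  jeq (# 2) (# 0) 26 ∷         -- 3
  jeq (# 3) (# 0) 12 ∷         -- 4
  jlt (# 2) (# 3) 10 ∷         -- 5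
  ldB (# 4) (# 3) ∷            -- 6
  jeq (# 4) (# 0) 10 ∷         -- 7
  jlt (# 2) (# 4) 10 ∷         -- 8
  jeq (# 0) (# 0) 12 ∷         -- 9
  sub (# 3) (# 3) (# 1) ∷      -- 10
  jeq (# 0) (# 0) 4 ∷          -- 11
  ldA (# 4) (# 2) ∷            -- 12
  jeq (# 4) (# 0) 22 ∷         -- 13
  ldB (# 5) (# 4) ∷            -- 14
  jeq (# 3) (# 0) 19 ∷         -- 15
  sub (# 6) (# 5) (# 4) ∷      -- 16
  sub (# 7) (# 2) (# 3) ∷      -- 17
  jlt (# 7) (# 6) 22 ∷         -- 18
  stA (# 2) (# 4) ∷            -- 19
  stB (# 2) (# 5) ∷            -- 20
  jeq (# 0) (# 0) 24 ∷         -- 21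
  stA (# 2) (# 3) ∷            -- 22
  stB (# 2) (# 2) ∷            -- 23
  sub (# 2) (# 2) (# 1) ∷      -- 24
  jeq (# 0) (# 0) 3 ∷          -- 25
  []

-- Step budgets at line 3 (state i, p) and at line 4 (state 1 + i, p): each decrement of p
-- costs at most 7 steps, the rest of an iteration of the outer loop at most 28.
outerBudget : ℕ → ℕ → ℕ
outerBudget i p = p * 7 + (i * 28 + 1)

scanBudget : ℕ → ℕ → ℕ
scanBudget i p = p * 7 + (i * 28 + 19)

choice-within-scanBudget : ∀ i p → 18 + outerBudget i p ≤ scanBudget i p
choice-within-scanBudget i p = ≤-reflexive (sym (expanded i p))
  where
  expanded : ∀ i p → p * 7 + (i * 28 + 19) ≡ 18 + (p * 7 + (i * 28 + 1))
  expanded = solve-∀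

scan-within-outerBudget : ∀ i p → 1 + scanBudget i p ≤ outerBudget (suc i) p
scan-within-outerBudget i p = subst (1 + scanBudget i p ≤_) (sym (expanded i p)) (m≤n+m _ 9)
  where
  expanded : ∀ i p → p * 7 + (suc i * 28 + 1) ≡ 9 + (1 + (p * 7 + (i * 28 + 19)))
  expanded = solve-∀

start-within-bound : ∀ n → 3 + outerBudget n n ≤ 35 * suc n
start-within-bound n = subst (3 + outerBudget n n ≤_) (expanded n) (m≤n+m _ 31)
  where
  expanded : ∀ n → 31 + (3 + (n * 7 + (n * 28 + 1))) ≡ 35 * suc n
  expanded = solve-∀

updN-same : ∀ f i v → updN f i v i ≡ v
updN-same f i v rewrite true-if-T (≡⇒≡ᵇ i i refl) = refl

updN-other : ∀ f {i j} v → i ≢ j → updN f i v j ≡ f j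
updN-other f {i} {j} v i≢j rewrite false-if-¬T {i ≡ᵇ j} (λ eq → i≢j (≡ᵇ⇒≡ i j eq)) = refl

module Correctness (n k : ℕ) (S A B : ℕ → ℕ) (1≤n : 1 ≤ n)
                   (specA : SpecA S n k A) (specB : SpecB S n k B) where
  open Uniqueness S n k
  open Arrays S n k A B specA specB

  W : ℕ
  W = (n + 2) ^ 1

  open Machine W n k S program
  open Execution W n k S program

  fits : ∀ {v} → v ≤ suc n → v < W
  fits {v} v≤1+n = subst (v <_) (trans (+-comm 2 n) (sym (*-identityʳ (n + 2)))) (s≤s v≤1+n)

  Solved : Config 8 → Set
  Solved c = ∀ j → 1 ≤ j → j ≤ n → IsSUS S n k (arrA c j) (arrB c j) j

  Done : ℕ → Config 8 → Set
  Done = HaltsWithin Solved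

  -- A function rather than a record, so that Registers (upd g r v) i p reduces to Registers g i p
  -- for every scratch register r.
  Registers : (Fin 8 → ℕ) → ℕ → ℕ → Set
  Registers g i p = g (# 0) ≡ 0 × g (# 1) ≡ 1 × g (# 2) ≡ i × g (# 3) ≡ p

  record Memory (a b : ℕ → ℕ) (i p : ℕ) : Set where
    field
      i≤n : i ≤ n
      p≤1+i : p ≤ suc i
      A-kept : ∀ j → j ≤ i → a j ≡ A j
      B-kept : ∀ j → j ≤ i → b j ≡ B j
      solved : ∀ j → i < j → j ≤ n → IsSUS S n k (a j) (b j) j
      scanned : NoLSUSWithin p i
  open Memory

  memory-after-skip : ∀ {a b i p} → Skippable i (suc p) → Memory a b i (suc p) → Memory a b i p
  memory-after-skip {p = p} passed mem = record
    { i≤n = i≤n mem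
    ; p≤1+i = ≤-trans (n≤1+n p) (p≤1+i mem)
    ; A-kept = A-kept mem
    ; B-kept = B-kept mem
    ; solved = solved mem
    ; scanned = NoLSUSWithin-extendˡ passed (scanned mem)
    }

  memory-after-store : ∀ {a b i p x y c} → c ≡ suc i → p ≤ suc i → IsSUS S n k x y (suc i) →
                  Memory a b (suc i) p → Memory (updN a c x) (updN b c y) i p
  memory-after-store {a} {b} {i} {x = x} {y} refl p≤1+i sus mem = record
    { i≤n = ≤-trans (n≤1+n i) (i≤n mem)
    ; p≤1+i = p≤1+i
    ; A-kept = λ j j≤i → trans (updN-other a x (≢-below j≤i)) (A-kept mem j (m≤n⇒m≤1+n j≤i))
    ; B-kept = λ j j≤i → trans (updN-other b y (≢-below j≤i)) (B-kept mem j (m≤n⇒m≤1+n j≤i))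
    ; solved = solved′
    ; scanned = NoLSUSWithin-shrinkʳ (scanned mem)
    }
    where
    ≢-below : ∀ {j} → j ≤ i → suc i ≢ j
    ≢-below j≤i 1+i≡j = 1+n≰n (subst (_≤ i) (sym 1+i≡j) j≤i)

    solved′ : ∀ j → i < j → j ≤ n → IsSUS S n k (updN a (suc i) x j) (updN b (suc i) y j) j
    solved′ j i<j j≤n with suc i ≟ j
    ... | yes refl rewrite updN-same a (suc i) x | updN-same b (suc i) y = sus
    ... | no 1+i≢j rewrite updN-other a x 1+i≢j | updN-other b y 1+i≢j =
      solved mem j (≤∧≢⇒< i<j 1+i≢j) j≤n

  module Iteration (i₀ : ℕ)
    (continue : ∀ {g a b p} → Registers g i₀ p → Memory a b i₀ p → Done (outerBudget i₀ p) (cfg 3 g a b))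
    where

    i : ℕ
    i = suc i₀

    1≤rᵢ : ∀ {x} → x ≡ i → 1 ≤ x
    1≤rᵢ refl = s≤s z≤n

    rᵢ≤n : ∀ {x a b p} → x ≡ i → Memory a b i p → x ≤ n
    rᵢ≤n refl mem = i≤n mem

    advance : ∀ {g a b p} → Registers g i p → Memory a b i₀ p → Done (2 + outerBudget i₀ p) (cfg 24 g a b)
    advance {g} (r0 , r1 , ri , rp) mem =
      write-ok (# 2) (fits (subst (_≤ suc n) (sym rᵢ₋₁) (m≤n⇒m≤1+n (i≤n mem)))) ▸
      jeq-taken (# 0) (# 0) refl ▸
      continue (r0 , r1 , rᵢ₋₁ , rp) mem
      where
      rᵢ₋₁ : g (# 2) ∸ g (# 1) ≡ i₀
      rᵢ₋₁ = cong₂ _∸_ ri r1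

    store-sls : ∀ {g a b p} → Registers g i p → Memory a b i p → p ≤ i →
                IsSUS S n k (g (# 4)) (g (# 5)) i → Done (5 + outerBudget i₀ p) (cfg 19 g a b)
    store-sls regs@(_ , _ , ri , _) mem p≤i sus =
      stA-ok (# 2) (# 4) (1≤rᵢ ri) (rᵢ≤n ri mem) ▸
      stB-ok (# 2) (# 5) (1≤rᵢ ri) (rᵢ≤n ri mem) ▸
      jeq-taken (# 0) (# 0) refl ▸
      advance regs (memory-after-store ri p≤i sus mem)

    store-prefix : ∀ {g a b p} → Registers g i p → Memory a b i p → p ≤ i →
                   IsSUS S n k (g (# 3)) (g (# 2)) i → Done (4 + outerBudget i₀ p) (cfg 22 g a b)
    store-prefix regs@(_ , _ , ri , _) mem p≤i sus =
      stA-ok (# 2) (# 3) (1≤rᵢ ri) (rᵢ≤n ri mem) ▸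
      stB-ok (# 2) (# 2) (1≤rᵢ ri) (rᵢ≤n ri mem) ▸
      advance regs (memory-after-store ri p≤i sus mem)

    A-at-rᵢ : ∀ {x a b p} → x ≡ i → Memory a b i p → a x ≡ A i
    A-at-rᵢ refl mem = A-kept mem i ≤-refl

    sls-isSUS-at : ∀ {a b p x y} → Memory a b i p → x ≡ A i → y ≡ B (A i) → A i ≢ NIL →
                   (1 ≤ p → B (A i) ∸ A i ≤ i ∸ p) → IsSUS S n k x y i
    sls-isSUS-at mem refl refl = sls-isSUS (s≤s z≤n) (i≤n mem) (scanned mem)

    compare-lengths : ∀ {g a b p} → Registers g i p → Memory a b i p → ScanStopped p i →
                      g (# 4) ≡ A i → g (# 5) ≡ B (A i) → A i ≢ NIL →
                      Done (9 + outerBudget i₀ p) (cfg 15 g a b)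
    compare-lengths {g} {a} {b} {p} regs@(r0 , _ , ri , rp) mem stopped r4 r5 Ai≢NIL with p ≟ 0 | stopped
    ... | yes p≡0 | _ =
      halts-later 3 (
        jeq-taken (# 3) (# 0) (trans rp (trans p≡0 (sym r0))) ▸
        store-sls regs mem (ScanStopped⇒p≤i stopped)
          (sls-isSUS-at mem r4 r5 Ai≢NIL (λ 1≤p → ⊥-elim (1+n≰n (subst (1 ≤_) p≡0 1≤p)))))
    ... | no p≢0 | inj₁ p≡0 = ⊥-elim (p≢0 p≡0)
    ... | no p≢0 | inj₂ (p≤i , Bp≢NIL , Bp≤i) =
      jeq-skipped (# 3) (# 0) (λ r3≡r0 → p≢0 (trans (sym rp) (trans r3≡r0 r0))) ▸
      write-ok (# 6) (fits (subst (_≤ suc n) (sym r₆) (≤-trans (m∸n≤m _ (A i)) B≤1+n))) ▸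
      write-ok (# 7) (fits (subst (_≤ suc n) (sym r₇) (≤-trans (m∸n≤m i p) (m≤n⇒m≤1+n (i≤n mem))))) ▸
      compare
      where
      r₆ : g (# 5) ∸ g (# 4) ≡ B (A i) ∸ A i
      r₆ = cong₂ _∸_ r5 r4

      r₇ : g (# 2) ∸ g (# 3) ≡ i ∸ p
      r₇ = cong₂ _∸_ ri rp

      B≤1+n : B (A i) ≤ suc n
      B≤1+n = m≤n⇒m≤1+n (B≤n (n≢0⇒n>0 Ai≢NIL) (≤-trans (A≤ (s≤s z≤n) (i≤n mem)) (i≤n mem)))

      compare : Done (6 + outerBudget i₀ p)
                  (cfg 18 (upd (upd g (# 6) (g (# 5) ∸ g (# 4))) (# 7) (g (# 2) ∸ g (# 3))) a b)
      compare with i ∸ p <? B (A i) ∸ A i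
      ... | yes shorter =
        halts-later 1 (
          jlt-taken (# 7) (# 6) (subst₂ _<_ (sym r₇) (sym r₆) shorter) ▸
          store-prefix regs mem p≤i
            (subst₂ (λ x y → IsSUS S n k x y i) (sym rp) (sym ri)
              (prefix-isSUS-shorter (i≤n mem) (scanned mem) (n≢0⇒n>0 p≢0) p≤i Bp≢NIL Bp≤i shorter)))
      ... | no not-shorter =
        jlt-skipped (# 7) (# 6) (λ lt → not-shorter (subst₂ _<_ r₇ r₆ lt)) ▸
        store-sls regs mem p≤i (sls-isSUS-at mem r4 r5 Ai≢NIL (λ _ → ≮⇒≥ not-shorter))

    load-sls-end : ∀ {g a b p} → Registers g i p → Memory a b i p → ScanStopped p i →
                   g (# 4) ≡ A i → A i ≢ NIL → Done (10 + outerBudget i₀ p) (cfg 14 g a b)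
    load-sls-end {g} {b = b} regs mem stopped r4 Ai≢NIL =
      ldB-ok {g = g} (# 5) (# 4) (subst (1 ≤_) (sym r4) 1≤Ai) (subst (_≤ n) (sym r4) Ai≤n)
        (fits (subst (_≤ suc n) (sym r5) (m≤n⇒m≤1+n (B≤n 1≤Ai Ai≤n)))) ▸
      compare-lengths regs mem stopped r4 r5 Ai≢NIL
      where
      1≤Ai : 1 ≤ A i
      1≤Ai = n≢0⇒n>0 Ai≢NIL

      Ai≤i : A i ≤ i
      Ai≤i = A≤ (s≤s z≤n) (i≤n mem)

      Ai≤n : A i ≤ n
      Ai≤n = ≤-trans Ai≤i (i≤n mem)

      r5 : b (g (# 4)) ≡ B (A i)
      r5 = trans (cong b r4) (B-kept mem (A i) Ai≤i)

    test-sls : ∀ {g a b p} → Registers g i p → Memory a b i p → ScanStopped p i →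
               g (# 4) ≡ A i → Done (11 + outerBudget i₀ p) (cfg 13 g a b)
    test-sls regs@(r0 , _ , ri , rp) mem stopped r4 with A i ≟ NIL
    ... | yes Ai≡NIL =
      halts-later 6 (
        jeq-taken (# 4) (# 0) (trans r4 (trans Ai≡NIL (sym r0))) ▸
        store-prefix regs mem (ScanStopped⇒p≤i stopped)
          (subst₂ (λ x y → IsSUS S n k x y i) (sym rp) (sym ri)
            (prefix-isSUS-nil 1≤n (s≤s z≤n) (i≤n mem) (scanned mem) stopped Ai≡NIL)))
    ... | no Ai≢NIL =
      jeq-skipped (# 4) (# 0) (λ r4≡r0 → Ai≢NIL (trans (sym r4) (trans r4≡r0 r0))) ▸
      load-sls-end regs mem stopped r4 Ai≢NIL

    choose : ∀ {g a b p} → Registers g i p → Memory a b i p → ScanStopped p i →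
             Done (12 + outerBudget i₀ p) (cfg 12 g a b)
    choose {g} {a} regs@(_ , _ , ri , _) mem stopped =
      ldA-ok {g = g} (# 4) (# 2) (1≤rᵢ ri) (rᵢ≤n ri mem) (fits (subst (_≤ suc n) (sym r4) Ai≤1+n)) ▸
      test-sls regs mem stopped r4
      where
      r4 : a (g (# 2)) ≡ A i
      r4 = A-at-rᵢ ri mem

      Ai≤1+n : A i ≤ suc n
      Ai≤1+n = ≤-trans (A≤ (s≤s z≤n) (i≤n mem)) (m≤n⇒m≤1+n (i≤n mem))

    test-lsus-end : ∀ {g a b p} → Registers g i (suc p) → Memory a b i (suc p) → suc p ≤ i →
                    g (# 4) ≡ B (suc p) →
                    (∀ {g'} → Registers g' i (suc p) → Skippable i (suc p) →
                      Done (2 + scanBudget i₀ p) (cfg 10 g' a b)) →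
                    Done (4 + scanBudget i₀ p) (cfg 7 g a b)
    test-lsus-end {p = p} regs@(r0 , _ , ri , _) mem 1+p≤i r4 skip with B (suc p) ≟ NIL
    ... | yes Bp≡NIL =
      halts-later 1 (
        jeq-taken (# 4) (# 0) (trans r4 (trans Bp≡NIL (sym r0))) ▸
        skip regs (inj₂ (inj₁ Bp≡NIL)))
    ... | no Bp≢NIL with i <? B (suc p)
    ...   | yes i<Bp =
      jeq-skipped (# 4) (# 0) (λ r4≡r0 → Bp≢NIL (trans (sym r4) (trans r4≡r0 r0))) ▸
      jlt-taken (# 2) (# 4) (subst₂ _<_ (sym ri) (sym r4) i<Bp) ▸
      skip regs (inj₂ (inj₂ i<Bp))
    ...   | no i≮Bp =
      halts-mono (+-monoʳ-≤ 4 (choice-within-scanBudget i₀ p)) (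
        jeq-skipped (# 4) (# 0) (λ r4≡r0 → Bp≢NIL (trans (sym r4) (trans r4≡r0 r0))) ▸
        jlt-skipped (# 2) (# 4) (λ lt → i≮Bp (subst₂ _<_ ri r4 lt)) ▸
        jeq-taken (# 0) (# 0) refl ▸
        choose regs mem (inj₂ (1+p≤i , Bp≢NIL , ≮⇒≥ i≮Bp)))

    scan : ∀ p {g a b} → Registers g i p → Memory a b i p → Done (scanBudget i₀ p) (cfg 4 g a b)
    scan zero regs@(r0 , _ , _ , rp) mem =
      halts-mono (choice-within-scanBudget i₀ 0) (halts-later 5 (
        jeq-taken (# 3) (# 0) (trans rp (sym r0)) ▸
        choose regs mem (inj₁ refl)))
    scan (suc p) {g} {a} {b} regs@(r0 , _ , ri , rp) mem =
      jeq-skipped (# 3) (# 0) (λ r3≡r0 → 1+n≢0 (trans (sym rp) (trans r3≡r0 r0))) ▸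
      test-start
      where
      skip : ∀ {g'} → Registers g' i (suc p) → Skippable i (suc p) → Done (2 + scanBudget i₀ p) (cfg 10 g' a b)
      skip {g'} (r0' , r1' , ri' , rp') passed =
        write-ok (# 3) (fits (subst (_≤ suc n) (sym rₚ₋₁) p≤1+n)) ▸
        jeq-taken (# 0) (# 0) refl ▸
        scan p (r0' , r1' , ri' , rₚ₋₁) (memory-after-skip passed mem)
        where
        rₚ₋₁ : g' (# 3) ∸ g' (# 1) ≡ p
        rₚ₋₁ = cong₂ _∸_ rp' r1'

        p≤1+n : p ≤ suc n
        p≤1+n = ≤-trans (n≤1+n p) (≤-trans (p≤1+i mem) (s≤s (i≤n mem)))

      test-start : Done (6 + scanBudget i₀ p) (cfg 5 g a b)
      test-start with i <? suc p
      ... | yes i<1+p =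
        halts-later 3 (
          jlt-taken (# 2) (# 3) (subst₂ _<_ (sym ri) (sym rp) i<1+p) ▸
          skip regs (inj₁ i<1+p))
      ... | no i≮1+p =
        jlt-skipped (# 2) (# 3) (λ lt → i≮1+p (subst₂ _<_ ri rp lt)) ▸
        ldB-ok {g = g} (# 4) (# 3) (subst (1 ≤_) (sym rp) (s≤s z≤n)) (subst (_≤ n) (sym rp) 1+p≤n)
          (fits (subst (_≤ suc n) (sym rB) (m≤n⇒m≤1+n (B≤n (s≤s z≤n) 1+p≤n)))) ▸
        test-lsus-end regs mem 1+p≤i rB skip
        where
        1+p≤i : suc p ≤ i
        1+p≤i = ≮⇒≥ i≮1+p

        1+p≤n : suc p ≤ n
        1+p≤n = ≤-trans 1+p≤i (i≤n mem)

        rB : b (g (# 3)) ≡ B (suc p)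
        rB = trans (cong b rp) (B-kept mem (suc p) 1+p≤i)

  outer : ∀ i {g a b p} → Registers g i p → Memory a b i p → Done (outerBudget i p) (cfg 3 g a b)
  outer zero {g} {a} {b} {p} (r0 , _ , ri , _) mem =
    halts-mono (m≤n+m 1 (p * 7)) (
      jeq-taken (# 2) (# 0) (trans ri (sym r0)) ▸
      (0 , z≤n , cfg 26 g a b , refl , ≤-refl , solved mem))
  outer (suc i) {p = p} regs@(r0 , _ , ri , _) mem =
    halts-mono (scan-within-outerBudget i p) (
      jeq-skipped (# 2) (# 0) (λ r2≡r0 → 1+n≢0 (trans (sym ri) (trans r2≡r0 r0))) ▸
      Iteration.scan i (outer i) p regs mem)

  initial-memory : Memory A B n n
  initial-memory = record
    { i≤n = ≤-refl
    ; p≤1+i = n≤1+n n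
    ; A-kept = λ _ _ → refl
    ; B-kept = λ _ _ → refl
    ; solved = λ j n<j j≤n → ⊥-elim (<⇒≱ n<j j≤n)
    ; scanned = λ j n<j j≤n → ⊥-elim (<⇒≱ n<j j≤n)
    }

  started : Done (35 * suc n) (initConfig A B)
  started =
    halts-mono (start-within-bound n) (
      write-ok (# 2) (fits (n≤1+n n)) ▸
      write-ok (# 3) (fits (n≤1+n n)) ▸
      write-ok (# 1) (fits (s≤s z≤n)) ▸
      outer n (refl , refl , refl , refl) initial-memory)

  terminates : Σ (Config 8) λ fin →
               run (35 * suc n) (initConfig A B) ≡ just fin × Halted fin × Solved fin
  terminates = halts-run started

lemma11 : Σ ℕ λ R → Σ (List (Instr R)) λ P → Σ ℕ λ c → Σ ℕ λ d →
    ∀ (n : ℕ) (S : ℕ → ℕ) (k : ℕ) (A B : ℕ → ℕ) →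
    k < n → SpecA S n k A → SpecB S n k B →
    Σ (Config R) λ fin →
      Machine.run ((n + 2) ^ d) n k S P (c * suc n) (initConfig A B) ≡ just fin ×
      Machine.Halted ((n + 2) ^ d) n k S P fin ×
      (∀ i → 1 ≤ i → i ≤ n → IsSUS S n k (arrA fin i) (arrB fin i) i)
lemma11 = 8 , program , 35 , 1 , λ n S k A B k<n specA specB →
  Correctness.terminates n k S A B (≤-trans (s≤s z≤n) k<n) specA specB
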